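{- Let $m\geq 2$, $n_1,\ldots,n_m\geq 2$ integers and $\sigma,\tau\in Sym(m)$. Then $$P^{\tau}_{n_{\sigma^{ -1}(1)},n_{\sigma^{ -1}(2)},\ldots,n_{\sigma^{ -1}(m)}}\cdot P^{\sigma}_{n_1,n_2,\ldots,n_m}=P^{\tau\sigma}_{n_1,n_2,\ldots,n_m},$$ where $\tau\sigma$ denotes the composition $(\tau\sigma)(k)=\tau(\sigma(k))$.
   Context: For positive integers $a,b$ and $1\le i\le a$, $1\le j\le b$, $E^{i,j}_{a\times b}$ denotes the $a\times b$ real matrix with entry $1$ in row $i$, column $j$ and $0$ elsewhere; $\otimes$ is the Kronecker product. For integers $k_1,\ldots,k_m\ge 2$ and $\rho\in Sym(m)$, the shuffling matrix is the $(k_1\cdots k_m)\times(k_1\cdots k_m)$ permutation matrix $$P^{\rho}_{k_1,\ldots,k_m}=\sum_{\substack{i_j=1,\ldots,k_j\\ j=1,\ldots,m}} E^{i_{\rho^{ -1}(1)},i_1}_{k_{\rho^{ -1}(1)}\times k_1}\otimes\cdots\otimes E^{i_{\rho^{ -1}(m)},i_m}_{k_{\rho^{ -1}(m)}\times k_m}.$$ -}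

module Defs where

open import Data.Nat using (ℕ; zero; suc; _+_; _*_)
open import Data.Fin using (Fin; zero; suc; remQuot; _≟_)
open import Data.Product using (_,_)
open import Data.Bool using (if_then_else_; _∧_)
open import Relation.Nullary.Decidable using (⌊_⌋)
open import Data.Fin.Permutation using (Permutation′; _⟨$⟩ˡ_)

-- Real matrices with 0/1 entries; entries are taken in ℕ.
Mat : ℕ → ℕ → Set
Mat a b = Fin a → Fin b → ℕ

E : (a b : ℕ) → Fin a → Fin b → Mat a b
E a b i j r c = if ⌊ r ≟ i ⌋ ∧ ⌊ c ≟ j ⌋ then 1 else 0

∑ : (a : ℕ) → (Fin a → ℕ) → ℕ
∑ zero    f = 0
∑ (suc a) f = f zero + ∑ a (λ x → f (suc x))

_·_ : {a b c : ℕ} → Mat a b → Mat b c → Mat a c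
_·_ {b = b} A B r c = ∑ b (λ k → A r k * B k c)

-- Kronecker product (standard row-major convention: index (i,k) ↦ i*c + k)
_⊗_ : {a b c d : ℕ} → Mat a b → Mat c d → Mat (a * c) (b * d)
_⊗_ {c = c} {d = d} A B r s with remQuot c r | remQuot d s
... | (r₁ , r₂) | (s₁ , s₂) = A r₁ s₁ * B r₂ s₂

prod : (m : ℕ) → (Fin m → ℕ) → ℕ
prod zero    k = 1
prod (suc m) k = k zero * prod m (λ j → k (suc j))

⨂ : (m : ℕ) (r c : Fin m → ℕ) → ((j : Fin m) → Mat (r j) (c j)) → Mat (prod m r) (prod m c)
⨂ zero    r c A = λ _ _ → 1
⨂ (suc m) r c A = A zero ⊗ ⨂ m (λ j → r (suc j)) (λ j → c (suc j)) (λ j → A (suc j))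

Index : (m : ℕ) → (Fin m → ℕ) → Set
Index m k = (j : Fin m) → Fin (k j)

cons : {m : ℕ} {k : Fin (suc m) → ℕ} → Fin (k zero) → Index m (λ j → k (suc j)) → Index (suc m) k
cons x i zero    = x
cons x i (suc j) = i j

∑ᴵ : (m : ℕ) (k : Fin m → ℕ) {a b : ℕ} → (Index m k → Mat a b) → Mat a b
∑ᴵ zero    k f = f (λ ())
∑ᴵ (suc m) k f r s = ∑ (k zero) (λ x → ∑ᴵ m (λ j → k (suc j)) (λ i → f (cons x i)) r s)

P : (m : ℕ) (ρ : Permutation′ m) (k : Fin m → ℕ) →
    Mat (prod m (λ j → k (ρ ⟨$⟩ˡ j))) (prod m k)
P m ρ k = ∑ᴵ m k (λ i →
  ⨂ m (λ j → k (ρ ⟨$⟩ˡ j)) k (λ j → E (k (ρ ⟨$⟩ˡ j)) (k j) (i (ρ ⟨$⟩ˡ j)) (i j)))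

-- P^ρ sends the basis vector of the multi-index (i₁,…,iₘ) to that of
-- (i_{ρ⁻¹(1)},…,i_{ρ⁻¹(m)}): it is the permutation matrix of an index shuffle.
-- A product of permutation matrices is the permutation matrix of the composite
-- map, and shuffling by σ and then by τ is shuffling by τσ.
module Submission where

open import Defs
open import Data.Nat using (ℕ; zero; suc; _≤_; _+_; _*_)
open import Data.Nat.Properties
  using (*-identityʳ; *-zeroʳ; *-assoc; +-identityʳ; *-commutativeSemigroup)
open import Data.Fin using (Fin; zero; suc; remQuot; combine; _≟_)
open import Data.Fin.Properties
  using (remQuot-combine; combine-remQuot; combine-injectiveˡ; combine-injectiveʳ)
open import Data.Fin.Permutation using (Permutation′; _⟨$⟩ˡ_; _∘ₚ_)
open import Data.Vec.Functional using (tail)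
open import Data.Product using (_×_; proj₁; proj₂)
open import Data.Bool using (true; false; if_then_else_)
open import Relation.Nullary using (¬_; yes; no; contradiction)
open import Function using (_∘_)
open import Relation.Nullary.Decidable using (⌊_⌋)
open import Relation.Binary.PropositionalEquality
open import Algebra.Properties.CommutativeSemigroup *-commutativeSemigroup using (interchange)

private
  variable
    a b m : ℕ

δ : Fin a → Fin a → ℕ
δ zero    zero    = 1
δ zero    (suc y) = 0
δ (suc x) zero    = 0
δ (suc x) (suc y) = δ x y

δ-refl : (x : Fin a) → δ x x ≡ 1
δ-refl zero    = refl
δ-refl (suc x) = δ-refl x

δ-≢ : {x y : Fin a} → ¬ x ≡ y → δ x y ≡ 0
δ-≢ {x = zero}  {zero}  x≢y = contradiction refl x≢y
δ-≢ {x = zero}  {suc y} x≢y = refl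
δ-≢ {x = suc x} {zero}  x≢y = refl
δ-≢ {x = suc x} {suc y} x≢y = δ-≢ (λ x≡y → x≢y (cong suc x≡y))

δ-sym : (x y : Fin a) → δ x y ≡ δ y x
δ-sym zero    zero    = refl
δ-sym zero    (suc y) = refl
δ-sym (suc x) zero    = refl
δ-sym (suc x) (suc y) = δ-sym x y

δ-≟ : (x y : Fin a) → δ x y ≡ (if ⌊ x ≟ y ⌋ then 1 else 0)
δ-≟ x y with x ≟ y
... | yes refl = δ-refl x
... | no x≢y   = δ-≢ x≢y

E-δ : (i : Fin a) (j : Fin b) (r : Fin a) (c : Fin b) → E a b i j r c ≡ δ r i * δ c j
E-δ i j r c rewrite δ-≟ r i | δ-≟ c j with ⌊ r ≟ i ⌋ | ⌊ c ≟ j ⌋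
... | false | _     = refl
... | true  | false = refl
... | true  | true  = refl

δ-combine : ∀ {p q} (x x′ : Fin p) (y y′ : Fin q) →
  δ (combine x y) (combine x′ y′) ≡ δ x x′ * δ y y′
δ-combine x x′ y y′ with x ≟ x′ | y ≟ y′
... | yes refl | yes refl = trans (δ-refl (combine x y)) (sym (cong₂ _*_ (δ-refl x) (δ-refl y)))
... | no x≢x′ | _ = trans (δ-≢ (x≢x′ ∘ combine-injectiveˡ x y x′ y′))
                          (sym (cong (_* δ y y′) (δ-≢ x≢x′)))
... | yes _ | no y≢y′ = trans (δ-≢ (y≢y′ ∘ combine-injectiveʳ x y x′ y′))
                              (sym (trans (cong (δ x x′ *_) (δ-≢ y≢y′)) (*-zeroʳ (δ x x′))))

∑-cong : ∀ a {f g : Fin a → ℕ} → (∀ x → f x ≡ g x) → ∑ a f ≡ ∑ a g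
∑-cong zero    f≗g = refl
∑-cong (suc a) f≗g = cong₂ _+_ (f≗g zero) (∑-cong a (f≗g ∘ suc))

∑-δʳ : ∀ a (x : Fin a) (g : Fin a → ℕ) → ∑ a (λ y → g y * δ y x) ≡ g x
∑-δʳ (suc a) zero g = begin
  g zero * 1 + ∑ a (λ y → g (suc y) * 0)  ≡⟨ cong₂ _+_ (*-identityʳ (g zero)) (∑-zero a (g ∘ suc)) ⟩
  g zero + 0                               ≡⟨ +-identityʳ (g zero) ⟩
  g zero                                   ∎
  where
  open ≡-Reasoning
  ∑-zero : ∀ a (h : Fin a → ℕ) → ∑ a (λ y → h y * 0) ≡ 0
  ∑-zero zero    h = refl
  ∑-zero (suc a) h = cong₂ _+_ (*-zeroʳ (h zero)) (∑-zero a (h ∘ suc))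
∑-δʳ (suc a) (suc x) g =
  trans (cong (_+ ∑ a (λ y → g (suc y) * δ y x)) (*-zeroʳ (g zero))) (∑-δʳ a x (g ∘ suc))

prod-cong : ∀ m {f g : Fin m → ℕ} → (∀ j → f j ≡ g j) → prod m f ≡ prod m g
prod-cong zero    f≗g = refl
prod-cong (suc m) f≗g = cong₂ _*_ (f≗g zero) (prod-cong m (f≗g ∘ suc))

prod-* : ∀ m (f g : Fin m → ℕ) → prod m (λ j → f j * g j) ≡ prod m f * prod m g
prod-* zero    f g = refl
prod-* (suc m) f g = trans (cong (f zero * g zero *_) (prod-* m (tail f) (tail g)))
                           (interchange (f zero) (g zero) _ _)

-- Mixed-radix (row-major) coordinates of an index of a Kronecker product,
-- matching the convention of _⊗_.
split : ∀ m (k : Fin (suc m) → ℕ) → Fin (prod (suc m) k) → Fin (k zero) × Fin (prod m (tail k))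
split m k = remQuot {k zero} (prod m (tail k))

decode : ∀ m (k : Fin m → ℕ) → Fin (prod m k) → Index m k
decode (suc m) k R = cons (proj₁ (split m k R)) (decode m (tail k) (proj₂ (split m k R)))

encode : ∀ m (k : Fin m → ℕ) → Index m k → Fin (prod m k)
encode zero    k i = zero
encode (suc m) k i = combine (i zero) (encode m (tail k) (i ∘ suc))

encode-cong : ∀ m (k : Fin m → ℕ) {i i′ : Index m k} →
  (∀ j → i j ≡ i′ j) → encode m k i ≡ encode m k i′
encode-cong zero    k i≗i′ = refl
encode-cong (suc m) k i≗i′ =
  cong₂ combine (i≗i′ zero) (encode-cong m (tail k) (i≗i′ ∘ suc))

decode-encode : ∀ m (k : Fin m → ℕ) (i : Index m k) j → decode m k (encode m k i) j ≡ i j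
decode-encode (suc m) k i zero =
  cong proj₁ (remQuot-combine (i zero) (encode m (tail k) (i ∘ suc)))
decode-encode (suc m) k i (suc j) = trans
  (cong (λ R → decode m (tail k) R j)
        (cong proj₂ (remQuot-combine (i zero) (encode m (tail k) (i ∘ suc)))))
  (decode-encode m (tail k) (i ∘ suc) j)

prod-δ-decode : ∀ m (k : Fin m → ℕ) R (i : Index m k) →
  prod m (λ j → δ (decode m k R j) (i j)) ≡ δ R (encode m k i)
prod-δ-decode zero    k zero i = refl
prod-δ-decode (suc m) k R    i =
  step R (proj₁ (split m k R)) (proj₂ (split m k R)) (combine-remQuot {k zero} (prod m (tail k)) R)
  where
  step : ∀ R x R′ → combine x R′ ≡ R →
    δ x (i zero) * prod m (λ j → δ (decode m (tail k) R′ j) (i (suc j)))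
      ≡ δ R (encode (suc m) k i)
  step _ x R′ refl = trans (cong (δ x (i zero) *_) (prod-δ-decode m (tail k) R′ (i ∘ suc)))
                           (sym (δ-combine x (i zero) R′ _))

⨂-decode : ∀ m (r c : Fin m → ℕ) (A : (j : Fin m) → Mat (r j) (c j)) R C →
  ⨂ m r c A R C ≡ prod m (λ j → A j (decode m r R j) (decode m c C j))
⨂-decode zero    r c A R C = refl
⨂-decode (suc m) r c A R C =
  cong (A zero (proj₁ (split m r R)) (proj₁ (split m c C)) *_)
       (⨂-decode m (tail r) (tail c) (A ∘ suc) (proj₂ (split m r R)) (proj₂ (split m c C)))

-- cons (x zero) (x ∘ suc) is only pointwise equal to x, hence the
-- extensionality hypothesis on g.
∑ᴵ-sift : ∀ m (k : Fin m → ℕ) {a b} (f : Index m k → Mat a b) (g : Index m k → ℕ)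
  (x : Index m k) r s →
  (∀ i i′ → (∀ j → i j ≡ i′ j) → g i ≡ g i′) →
  (∀ i → f i r s ≡ g i * prod m (λ j → δ (i j) (x j))) →
  ∑ᴵ m k f r s ≡ g x
∑ᴵ-sift zero k f g x r s g-ext f≡ =
  trans (f≡ _) (trans (*-identityʳ _) (g-ext _ x (λ ())))
∑ᴵ-sift (suc m) k f g x r s g-ext f≡ = begin
  ∑ (k zero) (λ y → ∑ᴵ m (tail k) (λ i → f (cons y i)) r s)
    ≡⟨ ∑-cong (k zero) (λ y → ∑ᴵ-sift m (tail k) (λ i → f (cons y i))
                                (λ i → g (cons y i) * δ y (x zero)) (x ∘ suc) r s
                                (λ i i′ i≗i′ → cong (_* δ y (x zero)) (g-ext _ _ (cons-cong i≗i′)))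
                                (λ i → trans (f≡ (cons y i)) (sym (*-assoc (g (cons y i)) _ _)))) ⟩
  ∑ (k zero) (λ y → g (cons y (x ∘ suc)) * δ y (x zero))
    ≡⟨ ∑-δʳ (k zero) (x zero) (λ y → g (cons y (x ∘ suc))) ⟩
  g (cons (x zero) (x ∘ suc))
    ≡⟨ g-ext _ x (λ { zero → refl ; (suc j) → refl }) ⟩
  g x ∎
  where
  open ≡-Reasoning
  cons-cong : ∀ {y} {i i′ : Index m (tail k)} → (∀ j → i j ≡ i′ j) →
    ∀ j → cons {k = k} y i j ≡ cons {k = k} y i′ j
  cons-cong i≗i′ zero    = refl
  cons-cong i≗i′ (suc j) = i≗i′ j

permute : (ρ : Permutation′ m) {k : Fin m → ℕ} → Index m k → Index m (λ j → k (ρ ⟨$⟩ˡ j))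
permute ρ i j = i (ρ ⟨$⟩ˡ j)

shuffle : ∀ m (ρ : Permutation′ m) (k : Fin m → ℕ) →
  Fin (prod m k) → Fin (prod m (λ j → k (ρ ⟨$⟩ˡ j)))
shuffle m ρ k C = encode m _ (permute ρ (decode m k C))

P-δ-shuffle : ∀ m (ρ : Permutation′ m) (k : Fin m → ℕ) R C →
  P m ρ k R C ≡ δ R (shuffle m ρ k C)
P-δ-shuffle m ρ k R C = trans
  (∑ᴵ-sift m k _ g (decode m k C) R C
    (λ i i′ i≗i′ → prod-cong m (λ j → cong (δ (decode m k′ R j)) (i≗i′ (ρ ⟨$⟩ˡ j))))
    (λ i → begin
      ⨂ m k′ k (λ j → E (k′ j) (k j) (i (ρ ⟨$⟩ˡ j)) (i j)) R C
        ≡⟨ ⨂-decode m k′ k _ R C ⟩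
      prod m (λ j → E (k′ j) (k j) (i (ρ ⟨$⟩ˡ j)) (i j) (decode m k′ R j) (decode m k C j))
        ≡⟨ prod-cong m (λ j → E-δ (i (ρ ⟨$⟩ˡ j)) (i j) (decode m k′ R j) (decode m k C j)) ⟩
      prod m (λ j → δ (decode m k′ R j) (i (ρ ⟨$⟩ˡ j)) * δ (decode m k C j) (i j))
        ≡⟨ prod-* m _ _ ⟩
      g i * prod m (λ j → δ (decode m k C j) (i j))
        ≡⟨ cong (g i *_) (prod-cong m (λ j → δ-sym (decode m k C j) (i j))) ⟩
      g i * prod m (λ j → δ (i j) (decode m k C j)) ∎))
  (prod-δ-decode m k′ R _)
  where
  open ≡-Reasoning
  k′ : Fin m → ℕ
  k′ j = k (ρ ⟨$⟩ˡ j)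
  g : Index m k → ℕ
  g i = prod m (λ j → δ (decode m k′ R j) (i (ρ ⟨$⟩ˡ j)))

shuffle-∘ₚ : ∀ m (σ τ : Permutation′ m) (n : Fin m → ℕ) C →
  shuffle m τ (λ j → n (σ ⟨$⟩ˡ j)) (shuffle m σ n C) ≡ shuffle m (σ ∘ₚ τ) n C
shuffle-∘ₚ m σ τ n C =
  encode-cong m _ (λ j → decode-encode m _ (permute σ (decode m n C)) (τ ⟨$⟩ˡ j))

proposition4p1 : (m : ℕ) → 2 ≤ m → (n : Fin m → ℕ) → (∀ j → 2 ≤ n j) →
    (σ τ : Permutation′ m) →
    ∀ r c → (P m τ (λ j → n (σ ⟨$⟩ˡ j)) · P m σ n) r c ≡ P m (σ ∘ₚ τ) n r c
proposition4p1 m _ n _ σ τ R C = begin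
  ∑ (prod m n′) (λ S → P m τ n′ R S * P m σ n S C)
    ≡⟨ ∑-cong (prod m n′) (λ S → cong₂ _*_ (P-δ-shuffle m τ n′ R S) (P-δ-shuffle m σ n S C)) ⟩
  ∑ (prod m n′) (λ S → δ R (shuffle m τ n′ S) * δ S (shuffle m σ n C))
    ≡⟨ ∑-δʳ (prod m n′) (shuffle m σ n C) (λ S → δ R (shuffle m τ n′ S)) ⟩
  δ R (shuffle m τ n′ (shuffle m σ n C))
    ≡⟨ cong (δ R) (shuffle-∘ₚ m σ τ n C) ⟩
  δ R (shuffle m (σ ∘ₚ τ) n C)
    ≡⟨ P-δ-shuffle m (σ ∘ₚ τ) n R C ⟨
  P m (σ ∘ₚ τ) n R C ∎
  where
  open ≡-Reasoning
  n′ : Fin m → ℕ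
  n′ j = n (σ ⟨$⟩ˡ j)
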